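{- Let $q\ge2$ be even and let $\mathbf f\in A_q^+$ be a forbidden factor whose last symbol is $0$ and which does not induce zero periodicity on $A_q^\infty$. Let $\mathbf p\in A_q^*(\mathbf f)$ be such that one of the $\prec$-first or the $\prec$-last word of $\mathbf p|A_q^\infty(\mathbf f)$ does not have ultimate period $0$, and let $\mathbf a$ be this word. Then there is $m\ge0$ such that either $\mathbf a=\mathbf p0^i(1(q-1)0^m)^\infty$ for some $i\le m$, or $\mathbf a=\mathbf p((q-1)0^m1)^\infty$.
   Context: $A_q=\{0,1,\dots,q-1\}$. $A_q^*$ (resp. $A_q^+$) is the set of all (resp. nonempty) finite words, $A_q^\infty$ the right-infinite words; $\mathbf a^i$ is $i$-fold concatenation, $\mathbf a^\infty=\mathbf a\mathbf a\cdots$. For a set $X$ of words, $X(\mathbf f)$ is the set of words of $X$ not containing $\mathbf f$ as a factor (contiguous subword), $\mathbf p|X$ the words of $X$ with prefix $\mathbf p$. An infinite word has ultimate period $\mathbf c\ne\epsilon$ if it equals $\mathbf b\mathbf c^\infty$ for a finite $\mathbf b$. For distinct words $\mathbf s,\mathbf t$ of the same (finite or infinite) length, with $k$ the leftmost differing position and $u=\sum_{i<k}s_i$, $\mathbf s\prec\mathbf t$ iff ($u$ even and $s_k<t_k$) or ($u$ odd and $s_k>t_k$); $\prec$-first/last mean least/greatest. For even $q$, $\mathbf f$ induces zero periodicity on $A_q^\infty$ if for every $\mathbf p\in A_q^*(\mathbf f)$ the $\prec$-first and $\prec$-last words of $\mathbf p|A_q^\infty(\mathbf f)$ both have ultimate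 period $0$. -}

module Defs where

open import Data.Nat using (ℕ; zero; suc; _+_; _≤_; _<_; s≤s; z≤n; _∸_)
open import Data.Nat.Properties using (≤-trans)
open import Data.Nat.Divisibility using (_∣_)
open import Data.Nat.DivMod using (_mod_)
open import Data.Fin as Fin using (Fin; toℕ; fromℕ<)
open import Data.List using (List; []; _∷_; length; lookup; _++_; [_]; replicate)
open import Data.List.NonEmpty using (List⁺; _∷_)
open import Data.List.Relation.Binary.Infix.Heterogeneous using (Infix)
open import Data.Product using (Σ; ∃; _×_)
open import Data.Sum using (_⊎_)
open import Relation.Nullary using (¬_)
open import Relation.Binary.PropositionalEquality using (_≡_)

-- Finite words over A_q : List (Fin q).  Infinite words : ℕ → Fin q.
Word∞ : ℕ → Set
Word∞ q = ℕ → Fin q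

_≈_ : ∀ {q} → Word∞ q → Word∞ q → Set
s ≈ t = ∀ n → s n ≡ t n

_⊙_ : ∀ {q} → List (Fin q) → Word∞ q → Word∞ q
([] ⊙ w) n = w n
((x ∷ xs) ⊙ w) zero = x
((x ∷ xs) ⊙ w) (suc n) = (xs ⊙ w) n

_^∞ : ∀ {q} → List⁺ (Fin q) → Word∞ q
((x ∷ xs) ^∞) n = lookup (x ∷ xs) (n mod suc (length xs))

UltPeriod : ∀ {q} → Word∞ q → List⁺ (Fin q) → Set
UltPeriod {q} w c = Σ (List (Fin q)) λ b → w ≈ (b ⊙ (c ^∞))

sym0 : ∀ {q} → 2 ≤ q → Fin q
sym0 h = fromℕ< (≤-trans (s≤s z≤n) h)

sym1 : ∀ {q} → 2 ≤ q → Fin q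
sym1 h = fromℕ< h

symLast : ∀ {q} → 2 ≤ q → Fin q
symLast {suc n} h = Fin.fromℕ n

zeroWord : ∀ {q} → 2 ≤ q → List⁺ (Fin q)
zeroWord h = sym0 h ∷ []

FactorOf : ∀ {q} → List (Fin q) → List (Fin q) → Set
FactorOf f p = Infix _≡_ f p

Avoids : ∀ {q} → List (Fin q) → List (Fin q) → Set
Avoids f p = ¬ FactorOf f p

FactorOf∞ : ∀ {q} → List (Fin q) → Word∞ q → Set
FactorOf∞ f w = Σ ℕ λ n → (i : Fin (length f)) → w (n + toℕ i) ≡ lookup f i

Avoids∞ : ∀ {q} → List (Fin q) → Word∞ q → Set
Avoids∞ f w = ¬ FactorOf∞ f w

HasPrefix : ∀ {q} → List (Fin q) → Word∞ q → Set
HasPrefix p w = (i : Fin (length p)) → w (toℕ i) ≡ lookup p i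

-- membership in p | A_q^∞(f)
InCyl : ∀ {q} → List (Fin q) → List (Fin q) → Word∞ q → Set
InCyl f p w = HasPrefix p w × Avoids∞ f w

prefixSum : ∀ {q} → Word∞ q → ℕ → ℕ
prefixSum s zero = 0
prefixSum s (suc k) = prefixSum s k + toℕ (s k)

_≺_ : ∀ {q} → Word∞ q → Word∞ q → Set
s ≺ t = Σ ℕ λ k → ((i : ℕ) → i < k → s i ≡ t i) ×
          (((2 ∣ prefixSum s k) × (s k Fin.< t k)) ⊎
           ((¬ (2 ∣ prefixSum s k)) × (t k Fin.< s k)))

IsFirst : ∀ {q} → List (Fin q) → List (Fin q) → Word∞ q → Set
IsFirst f p a = InCyl f p a × (∀ b → InCyl f p b → ¬ (b ≈ a) → a ≺ b)

IsLast : ∀ {q} → List (Fin q) → List (Fin q) → Word∞ q → Set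
IsLast f p a = InCyl f p a × (∀ b → InCyl f p b → ¬ (b ≈ a) → b ≺ a)

ZeroPeriodicity : ∀ {q} → 2 ≤ q → List (Fin q) → Set
ZeroPeriodicity {q} h f = (p : List (Fin q)) → Avoids f p →
  (∀ a → IsFirst f p a → UltPeriod a (zeroWord h)) ×
  (∀ a → IsLast f p a → UltPeriod a (zeroWord h))

module Submission where

-- Let q = n + 1 be even, f = g·0, and let a be the ≺-first or ≺-last word of
-- p|A_q^∞(f), not ultimately 0.  Comparing a with the competitors that follow a up to a
-- position e ≥ |p|, put a symbol c at e and continue with 1s (they avoid f whenever c ≠ 0,
-- because f ends in 0) shows that a is greedy: at a "high" position (prefix sum of the parity
-- fixed by a being first or last) a carries the largest symbol q−1; at a "low" position it
-- carries 0 unless 0 would complete f, and 1 otherwise.  As q−1 and 1 are odd, after |p| the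
-- word is made of runs of 0s at low positions, each closed by a 1 forced by f and followed by
-- q−1.  Runs are finite since a is not ultimately 0, and comparing the occurrences of f that
-- close two runs shows that all runs following a nonzero symbol have a common length m, while
-- a leading run right after p has length i ≤ m.  Reading off the blocks gives the two shapes.

open import Defs
open import Data.Nat using (ℕ; zero; suc; _+_; _*_; _∸_; _≤_; _<_; z≤n; s≤s; z<s)
open import Data.Nat.Properties
open import Data.Nat.Divisibility using (_∣_; m%n≡0⇒n∣m; n∣m⇒m%n≡0)
open import Data.Nat.DivMod using (_%_; _/_; _mod_; m%n<n; m≡m%n+[m/n]*n; %-distribˡ-+)
open import Data.Fin as F using (Fin; toℕ; fromℕ<)
open import Data.Fin.Properties using (toℕ-fromℕ<; toℕ-fromℕ; toℕ<n; toℕ-injective) renaming (_≟_ to _≟F_)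
open import Data.List using (List; []; _∷_; _++_; [_]; replicate; length; lookup)
open import Data.List.Properties using (length-++; length-replicate)
open import Data.List.NonEmpty using (_∷_)
open import Data.Product using (Σ; _×_; _,_; proj₁; proj₂)
open import Data.Sum using (_⊎_; inj₁; inj₂)
open import Data.Empty using (⊥; ⊥-elim)
open import Relation.Nullary using (¬_; yes; no)
open import Relation.Nullary.Decidable using (decidable-stable)
open import Relation.Binary.PropositionalEquality
  using (_≡_; _≢_; refl; sym; trans; cong; cong₂; subst; module ≡-Reasoning)
open import Relation.Binary.Definitions using (tri<; tri≈; tri>)

-- an occurrence of length L + 1 that ends at lo + k, with L ≤ k, starts at or after lo
start-after : ∀ {s L lo k} → s + L ≡ lo + k → L ≤ k → lo ≤ s
start-after {s} {L} {lo} {k} eq L≤k =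
  +-cancelʳ-≤ L lo s (≤-trans (+-monoʳ-≤ lo L≤k) (≤-reflexive (sym eq)))

shift-back : ∀ s d c x → s + (c + d) ≡ x + c → s + d ≡ x
shift-back s d c x eq =
  +-cancelʳ-≡ c (s + d) x (trans (trans (+-assoc s d c) (cong (s +_) (+-comm d c))) eq)

mod2-cases : ∀ x → x % 2 ≡ 0 ⊎ x % 2 ≡ 1
mod2-cases x = bit (m%n<n x 2)
  where
  bit : ∀ {r} → r < 2 → r ≡ 0 ⊎ r ≡ 1
  bit {0} _ = inj₁ refl
  bit {1} _ = inj₂ refl
  bit {suc (suc _)} (s≤s (s≤s ()))

odd-step-flips : ∀ x y → y % 2 ≡ 1 → (x + y) % 2 ≢ x % 2
odd-step-flips x y y-odd =
  flips (mod2-cases x) (trans (%-distribˡ-+ x y 2) (cong (λ z → (x % 2 + z) % 2) y-odd))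
  where
  flips : ∀ {r s} → r ≡ 0 ⊎ r ≡ 1 → s ≡ (r + 1) % 2 → s ≢ r
  flips (inj₁ refl) refl ()
  flips (inj₂ refl) refl ()

bit-third : ∀ {x y z} → x < 2 → y < 2 → z < 2 → x ≢ y → y ≢ z → x ≡ z
bit-third {suc (suc _)} (s≤s (s≤s ())) _ _ _ _
bit-third {_} {suc (suc _)} _ (s≤s (s≤s ())) _ _ _
bit-third {_} {_} {suc (suc _)} _ _ (s≤s (s≤s ())) _ _
bit-third {0} {0} _ _ _ x≢y _ = ⊥-elim (x≢y refl)
bit-third {1} {1} _ _ _ x≢y _ = ⊥-elim (x≢y refl)
bit-third {0} {1} {0} _ _ _ _ _ = refl
bit-third {1} {0} {1} _ _ _ _ _ = refl
bit-third {0} {1} {1} _ _ _ _ y≢z = ⊥-elim (y≢z refl)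
bit-third {1} {0} {0} _ _ _ _ y≢z = ⊥-elim (y≢z refl)

module _ {q : ℕ} where

  lookup-∷ʳ-last : ∀ (g : List (Fin q)) x (i : Fin (length (g ++ [ x ]))) →
                   toℕ i ≡ length g → lookup (g ++ [ x ]) i ≡ x
  lookup-∷ʳ-last []      x F.zero    _  = refl
  lookup-∷ʳ-last (y ∷ g) x (F.suc i) eq = lookup-∷ʳ-last g x i (suc-injective eq)

  replicate-lookup : ∀ m (x : Fin q) (i : Fin (length (replicate m x))) → lookup (replicate m x) i ≡ x
  replicate-lookup (suc m) x F.zero    = refl
  replicate-lookup (suc m) x (F.suc i) = replicate-lookup m x i

  replicate-∷ʳ-lookup : ∀ m (x y : Fin q) (i : Fin (length (replicate m x ++ [ y ]))) →
                        toℕ i < m → lookup (replicate m x ++ [ y ]) i ≡ x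
  replicate-∷ʳ-lookup (suc m) x y F.zero    _         = refl
  replicate-∷ʳ-lookup (suc m) x y (F.suc i) (s≤s i<m) = replicate-∷ʳ-lookup m x y i i<m

  graft : Word∞ q → ℕ → Fin q → Fin q → Word∞ q
  graft a zero    c o zero    = c
  graft a zero    c o (suc t) = o
  graft a (suc e) c o zero    = a zero
  graft a (suc e) c o (suc t) = graft (λ x → a (suc x)) e c o t

  graft-below : ∀ a e c o t → t < e → graft a e c o t ≡ a t
  graft-below a (suc e) c o zero    _         = refl
  graft-below a (suc e) c o (suc t) (s≤s t<e) = graft-below (λ x → a (suc x)) e c o t t<e

  graft-at : ∀ a e c o → graft a e c o e ≡ c
  graft-at a zero    c o = refl
  graft-at a (suc e) c o = graft-at (λ x → a (suc x)) e c o

  graft-above : ∀ a e c o t → e < t → graft a e c o t ≡ o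
  graft-above a zero    c o (suc t) _         = refl
  graft-above a (suc e) c o (suc t) (s≤s e<t) = graft-above (λ x → a (suc x)) e c o t e<t

  prefixSum-cong : ∀ (s t : Word∞ q) k → (∀ i → i < k → s i ≡ t i) → prefixSum s k ≡ prefixSum t k
  prefixSum-cong s t zero    agree = refl
  prefixSum-cong s t (suc k) agree =
    cong₂ _+_ (prefixSum-cong s t k (λ i i<k → agree i (m<n⇒m<1+n i<k))) (cong toℕ (agree k ≤-refl))

  ≺-at : ∀ (s t : Word∞ q) k → s ≺ t → (∀ i → i < k → s i ≡ t i) → s k ≢ t k →
         ((2 ∣ prefixSum s k) × (s k F.< t k)) ⊎ ((¬ (2 ∣ prefixSum s k)) × (t k F.< s k))
  ≺-at s t k (j , agree , decided) agree-k differ with <-cmp j k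
  ... | tri≈ _ refl _ = decided
  ... | tri> _ _ k<j  = ⊥-elim (differ (agree k k<j))
  ... | tri< j<k _ _  with decided
  ...   | inj₁ (_ , lt) = ⊥-elim (<-irrefl (cong toℕ (agree-k j j<k)) lt)
  ...   | inj₂ (_ , lt) = ⊥-elim (<-irrefl (cong toℕ (sym (agree-k j j<k))) lt)

  extremal-in-cylinder : ∀ {f p : List (Fin q)} {a} → IsFirst f p a ⊎ IsLast f p a → InCyl f p a
  extremal-in-cylinder (inj₁ (in-cylinder , _)) = in-cylinder
  extremal-in-cylinder (inj₂ (in-cylinder , _)) = in-cylinder

  ⊙-intro : ∀ (p : List (Fin q)) (a w : Word∞ q) → HasPrefix p a →
            (∀ u → a (length p + u) ≡ w u) → a ≈ (p ⊙ w)
  ⊙-intro []      a w _      rest t       = rest t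
  ⊙-intro (x ∷ p) a w prefix rest zero    = prefix F.zero
  ⊙-intro (x ∷ p) a w prefix rest (suc t) =
    ⊙-intro p (λ u → a (suc u)) w (λ i → prefix (F.suc i)) rest t

  replicate-⊙-intro : ∀ i x (a w : Word∞ q) → (∀ u → u < i → a u ≡ x) →
                      (∀ u → a (i + u) ≡ w u) → a ≈ (replicate i x ⊙ w)
  replicate-⊙-intro zero    x a w _     rest t       = rest t
  replicate-⊙-intro (suc i) x a w start rest zero    = start zero (s≤s z≤n)
  replicate-⊙-intro (suc i) x a w start rest (suc t) =
    replicate-⊙-intro i x (λ u → a (suc u)) w (λ u u<i → start (suc u) (s≤s u<i)) rest t

  ⊙-++ : ∀ (p r : List (Fin q)) w → ((p ++ r) ⊙ w) ≈ (p ⊙ (r ⊙ w))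
  ⊙-++ []      r w t       = refl
  ⊙-++ (x ∷ p) r w zero    = refl
  ⊙-++ (x ∷ p) r w (suc t) = ⊙-++ p r w t

  constant-tail-ultPeriod : ∀ (z : Fin q) e (a : Word∞ q) → (∀ u → a (e + u) ≡ z) → UltPeriod a (z ∷ [])
  constant-tail-ultPeriod z zero a const = [] , λ t → trans (const t) (sym (single (t mod 1)))
    where
    single : (i : Fin 1) → lookup (z ∷ []) i ≡ z
    single F.zero = refl
  constant-tail-ultPeriod z (suc e) a const with constant-tail-ultPeriod z e (λ t → a (suc t)) const
  ... | b , eq = (a zero ∷ b) , λ { zero → refl ; (suc t) → eq t }

  -- a tail cut into consecutive copies of x ∷ xs is (x ∷ xs)^∞: Block marks where copies
  -- start, is passed on to the start of the next copy, and each marked place starts a copy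
  tail-periodic : ∀ (a : Word∞ q) x (xs : List (Fin q)) (Block : ℕ → Set) →
    (∀ M → Block M → Block (M + suc (length xs))) →
    (∀ M → Block M → ∀ i → a (M + toℕ i) ≡ lookup (x ∷ xs) i) →
    ∀ N → Block N → ∀ t → a (N + t) ≡ ((x ∷ xs) ^∞) t
  tail-periodic a x xs Block next copy N start t =
    begin
      a (N + t)                            ≡⟨ cong (λ z → a (N + z)) divmod ⟩
      a (N + (t / P * P + toℕ (t mod P)))  ≡⟨ cong a (sym (+-assoc N _ _)) ⟩
      a (N + t / P * P + toℕ (t mod P))    ≡⟨ copy _ (blocks (t / P)) (t mod P) ⟩
      lookup (x ∷ xs) (t mod P)            ∎
    where
    open ≡-Reasoning
    P : ℕ
    P = suc (length xs)
    blocks : ∀ j → Block (N + j * P)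
    blocks zero    = subst Block (sym (+-identityʳ N)) start
    blocks (suc j) = subst Block (trans (+-assoc N (j * P) P) (cong (N +_) (+-comm (j * P) P)))
                           (next _ (blocks j))
    divmod : t ≡ t / P * P + toℕ (t mod P)
    divmod = trans (m≡m%n+[m/n]*n t P)
                   (trans (+-comm (t % P) _) (cong (t / P * P +_) (sym (toℕ-fromℕ< (m%n<n t P)))))

-- The situation of the theorem: q = n + 1 ≥ 2, f = g·0, and a ∈ p|A_q^∞(f).
module Setting (n : ℕ) (h : 2 ≤ suc n) (g : List (Fin (suc n))) (p : List (Fin (suc n)))
               (a : Word∞ (suc n)) (a-in : InCyl (g ++ [ sym0 h ]) p a) where

  f : List (Fin (suc n))
  f = g ++ [ sym0 h ]

  L : ℕ
  L = length g

  length-f : length f ≡ suc L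
  length-f = trans (length-++ g) (+-comm L 1)

  index-bound : (i : Fin (length f)) → toℕ i ≤ L
  index-bound i = ≤-pred (subst (toℕ i <_) length-f (toℕ<n i))

  index : ∀ d → d ≤ L → Fin (length f)
  index d d≤L = fromℕ< (subst (d <_) (sym length-f) (s≤s d≤L))

  s0 s1 sTop : Fin (suc n)
  s0   = sym0 h
  s1   = sym1 h
  sTop = symLast h

  toℕ-s0 : toℕ s0 ≡ 0
  toℕ-s0 = toℕ-fromℕ< (≤-trans (s≤s z≤n) h)

  toℕ-s1 : toℕ s1 ≡ 1
  toℕ-s1 = toℕ-fromℕ< h

  toℕ-sTop : toℕ sTop ≡ n
  toℕ-sTop = toℕ-fromℕ n

  s1≢s0 : s1 ≢ s0
  s1≢s0 eq with trans (sym toℕ-s1) (trans (cong toℕ eq) toℕ-s0)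
  ... | ()

  sTop≢s0 : sTop ≢ s0
  sTop≢s0 eq = <-irrefl (trans (sym toℕ-s0) (trans (cong toℕ (sym eq)) toℕ-sTop)) (≤-pred h)

  nothing-above-sTop : ∀ (x : Fin (suc n)) → ¬ (sTop F.< x)
  nothing-above-sTop x lt = <-irrefl refl (<-≤-trans lt (subst (toℕ x ≤_) (sym toℕ-sTop) (≤-pred (toℕ<n x))))

  nothing-below-s0 : ∀ (x : Fin (suc n)) → ¬ (x F.< s0)
  nothing-below-s0 x lt = n≮0 (subst (toℕ x <_) toℕ-s0 lt)

  below-s1 : ∀ (x : Fin (suc n)) → x F.< s1 → x ≡ s0
  below-s1 x lt = toℕ-injective (trans (n<1⇒n≡0 (subst (toℕ x <_) toℕ-s1 lt)) (sym toℕ-s0))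

  f-last : ∀ i → toℕ i ≡ L → lookup f i ≡ s0
  f-last = lookup-∷ʳ-last g s0

  occurrence-last : ∀ w (occ : FactorOf∞ f w) → w (proj₁ occ + L) ≡ s0
  occurrence-last w (s , occ) =
    subst (λ d → w (s + d) ≡ s0) (toℕ-fromℕ< _) (trans (occ (index L ≤-refl)) (f-last _ (toℕ-fromℕ< _)))

  -- the competitor of a that switches to c at position e and continues with 1s
  branch : ℕ → Fin (suc n) → Word∞ (suc n)
  branch e c = graft a e c s1

  -- since a avoids f and f ends in 0 but the tail of branch e c is 1s, every occurrence of f
  -- in branch e c ends exactly at e, and then c = 0
  branch-occurrence : ∀ e c → (occ : FactorOf∞ f (branch e c)) → proj₁ occ + L ≡ e × c ≡ s0
  branch-occurrence e c (s , occ) with <-cmp (s + L) e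
  ... | tri< before _ _ = ⊥-elim (proj₂ a-in (s , λ i →
          trans (sym (graft-below a e c s1 _ (≤-<-trans (+-monoʳ-≤ s (index-bound i)) before))) (occ i)))
  ... | tri≈ _ at _ = at , trans (sym (graft-at a e c s1))
                                 (subst (λ x → branch e c x ≡ s0) at (occurrence-last (branch e c) (s , occ)))
  ... | tri> _ _ after = ⊥-elim (s1≢s0 (trans (sym (graft-above a e c s1 _ after))
                                              (occurrence-last (branch e c) (s , occ))))

  branch-avoids : ∀ e c → c ≢ s0 → Avoids∞ f (branch e c)
  branch-avoids e c c≢s0 occ = c≢s0 (proj₂ (branch-occurrence e c occ))

  -- Bad e: writing 0 at position e (after a's prefix) completes an occurrence of f
  Bad : ℕ → Set
  Bad e = FactorOf∞ f (branch e s0)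

  bad-reads : ∀ e (bad : Bad e) → proj₁ bad + L ≡ e ×
              (∀ i → toℕ i < L → a (proj₁ bad + toℕ i) ≡ lookup f i)
  bad-reads e (s , occ) = ends , λ i i<L →
    trans (sym (graft-below a e s0 s1 _ (subst (s + toℕ i <_) ends (+-monoʳ-< s i<L)))) (occ i)
    where
    ends : s + L ≡ e
    ends = proj₁ (branch-occurrence e s0 (s , occ))

  rival : ∀ e c → length p ≤ e → Avoids∞ f (branch e c) → a e ≢ c →
          InCyl f p (branch e c) × ¬ (branch e c ≈ a)
  rival e c le avoids differ =
    ((λ i → trans (graft-below a e c s1 (toℕ i) (<-≤-trans (toℕ<n i) le)) (proj₁ a-in i)) , avoids) ,
    (λ same → differ (trans (sym (same e)) (graft-at a e c s1)))

  -- parity of the sum of the symbols before position e; it decides how ≺ compares at e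
  parity : ℕ → ℕ
  parity e = prefixSum a e % 2

  Greedy : ℕ → Set
  Greedy β = ∀ e c → length p ≤ e → Avoids∞ f (branch e c) → a e ≢ c →
             (parity e ≡ β → c F.< a e) × (parity e ≢ β → a e F.< c)

  parity≢1⇒even : ∀ e → parity e ≢ 1 → 2 ∣ prefixSum a e
  parity≢1⇒even e ≢1 with mod2-cases (prefixSum a e)
  ... | inj₁ ≡0 = m%n≡0⇒n∣m _ 2 ≡0
  ... | inj₂ ≡1 = ⊥-elim (≢1 ≡1)

  first-greedy : (∀ b → InCyl f p b → ¬ (b ≈ a) → a ≺ b) → Greedy 1
  first-greedy least e c le avoids differ = decide
    (≺-at a (branch e c) e (least _ (proj₁ rv) (proj₂ rv))
          (λ i i<e → sym (graft-below a e c s1 i i<e)) (λ eq → differ (trans eq (graft-at a e c s1))))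
    where
    rv : InCyl f p (branch e c) × ¬ (branch e c ≈ a)
    rv = rival e c le avoids differ
    at-e : branch e c e ≡ c
    at-e = graft-at a e c s1
    decide : ((2 ∣ prefixSum a e) × (a e F.< branch e c e)) ⊎ ((¬ (2 ∣ prefixSum a e)) × (branch e c e F.< a e)) →
             (parity e ≡ 1 → c F.< a e) × (parity e ≢ 1 → a e F.< c)
    decide (inj₁ (even , lt)) = (λ odd → ⊥-elim (1≢0 (trans (sym odd) (n∣m⇒m%n≡0 _ 2 even)))) ,
                                (λ _ → subst (a e F.<_) at-e lt)
      where
      1≢0 : 1 ≢ 0
      1≢0 ()
    decide (inj₂ (odd , lt))  = (λ _ → subst (F._< a e) at-e lt) ,
                                (λ ≢1 → ⊥-elim (odd (parity≢1⇒even e ≢1)))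

  last-greedy : (∀ b → InCyl f p b → ¬ (b ≈ a) → b ≺ a) → Greedy 0
  last-greedy greatest e c le avoids differ = decide
    (≺-at (branch e c) a e (greatest _ (proj₁ rv) (proj₂ rv))
          (graft-below a e c s1) (λ eq → differ (trans (sym eq) (graft-at a e c s1))))
    where
    rv : InCyl f p (branch e c) × ¬ (branch e c ≈ a)
    rv = rival e c le avoids differ
    at-e : branch e c e ≡ c
    at-e = graft-at a e c s1
    same-sum : prefixSum (branch e c) e ≡ prefixSum a e
    same-sum = prefixSum-cong (branch e c) a e (graft-below a e c s1)
    decide : ((2 ∣ prefixSum (branch e c) e) × (branch e c e F.< a e)) ⊎
             ((¬ (2 ∣ prefixSum (branch e c) e)) × (a e F.< branch e c e)) →
             (parity e ≡ 0 → c F.< a e) × (parity e ≢ 0 → a e F.< c)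
    decide (inj₁ (even , lt)) = (λ _ → subst (F._< a e) at-e lt) ,
                                (λ ≢0 → ⊥-elim (≢0 (n∣m⇒m%n≡0 _ 2 (subst (2 ∣_) same-sum even))))
    decide (inj₂ (odd , lt))  = (λ ≡0 → ⊥-elim (odd (subst (2 ∣_) (sym same-sum) (m%n≡0⇒n∣m _ 2 ≡0)))) ,
                                (λ _ → subst (a e F.<_) at-e lt)

  extremal-greedy : IsFirst f p a ⊎ IsLast f p a → Σ ℕ λ β → β < 2 × Greedy β
  extremal-greedy (inj₁ (_ , least))    = 1 , s≤s (s≤s z≤n) , first-greedy least
  extremal-greedy (inj₂ (_ , greatest)) = 0 , s≤s z≤n , last-greedy greatest

  -- The run structure of a greedy word that is not ultimately 0, for even q.
  module Shape (β : ℕ) (β<2 : β < 2) (greedy : Greedy β) (q-even : 2 ∣ suc n)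
               (not-ultimately-0 : ¬ UltPeriod a (zeroWord h)) where

    -- high positions are those where a prefers large symbols
    Hi : ℕ → Set
    Hi e = parity e ≡ β

    top-when-hi : ∀ {e} → length p ≤ e → Hi e → a e ≡ sTop
    top-when-hi {e} le hi = decidable-stable (a e ≟F sTop) λ differ →
      nothing-above-sTop (a e) (proj₁ (greedy e sTop le (branch-avoids e sTop sTop≢s0) differ) hi)

    zero-when-lo : ∀ {e} → length p ≤ e → ¬ Hi e → ¬ Bad e → a e ≡ s0
    zero-when-lo {e} le low good = decidable-stable (a e ≟F s0) λ differ →
      nothing-below-s0 (a e) (proj₂ (greedy e s0 le good differ) low)

    one-when-lo : ∀ {e} → length p ≤ e → ¬ Hi e → a e ≢ s0 → a e ≡ s1
    one-when-lo {e} le low nonzero = decidable-stable (a e ≟F s1) λ differ →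
      nonzero (below-s1 (a e) (proj₂ (greedy e s1 le (branch-avoids e s1 s1≢s0) differ) low))

    forced-by-f : ∀ {e} → length p ≤ e → ¬ Hi e → a e ≢ s0 → ¬ ¬ Bad e
    forced-by-f le low nonzero good = nonzero (zero-when-lo le low good)

    odd-symbol-flips : ∀ e → toℕ (a e) % 2 ≡ 1 → parity (suc e) ≢ parity e
    odd-symbol-flips e = odd-step-flips (prefixSum a e) (toℕ (a e))

    sTop-odd : toℕ sTop % 2 ≡ 1
    sTop-odd with mod2-cases n
    ... | inj₂ odd  = trans (cong (_% 2) toℕ-sTop) odd
    ... | inj₁ even = ⊥-elim (odd-step-flips n 1 refl
                                (trans (trans (cong (_% 2) (+-comm n 1)) (n∣m⇒m%n≡0 _ 2 q-even)) (sym even)))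

    hi-next : ∀ {e} → length p ≤ e → Hi e → ¬ Hi (suc e)
    hi-next {e} le hi hi′ =
      odd-symbol-flips e (subst (λ x → toℕ x % 2 ≡ 1) (sym (top-when-hi le hi)) sTop-odd) (trans hi′ (sym hi))

    one-makes-hi : ∀ {e} → ¬ Hi e → a e ≡ s1 → Hi (suc e)
    one-makes-hi {e} low one =
      bit-third (m%n<n (prefixSum a (suc e)) 2) (m%n<n (prefixSum a e) 2) β<2
                (odd-symbol-flips e (subst (λ x → toℕ x % 2 ≡ 1) (sym one) (cong (_% 2) toℕ-s1))) low

    zero-keeps-lo : ∀ {e} → ¬ Hi e → a e ≡ s0 → ¬ Hi (suc e)
    zero-keeps-lo {e} low is-zero hi′ = low (trans (sym same) hi′)
      where
      same : parity (suc e) ≡ parity e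
      same = cong (_% 2) (trans (cong (prefixSum a e +_)
                                      (trans (cong toℕ is-zero) toℕ-s0))
                                (+-identityʳ _))

    Zeros : ℕ → ℕ → Set
    Zeros lo k = ∀ r → r < k → a (lo + r) ≡ s0

    zero-inside : ∀ {lo k x} → Zeros lo k → lo ≤ x → x < lo + k → a x ≡ s0
    zero-inside {lo} {k} {x} zs lo≤x x<end = subst (λ y → a y ≡ s0) (m+[n∸m]≡n lo≤x)
      (zs (x ∸ lo) (+-cancelˡ-< lo _ _ (subst (_< lo + k) (sym (m+[n∸m]≡n lo≤x)) x<end)))

    zeros-snoc : ∀ {lo k} → Zeros lo k → a (lo + k) ≡ s0 → Zeros lo (suc k)
    zeros-snoc zs z r r≤k with m≤n⇒m<n∨m≡n (≤-pred r≤k)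
    ... | inj₁ r<k  = zs r r<k
    ... | inj₂ refl = z

    -- zeros keep the parity, so a run starting low stays low
    lo-through-zeros : ∀ {lo} k → ¬ Hi lo → Zeros lo k → ¬ Hi (lo + k)
    lo-through-zeros {lo} zero    low _  = subst (λ x → ¬ Hi x) (sym (+-identityʳ lo)) low
    lo-through-zeros {lo} (suc k) low zs = subst (λ x → ¬ Hi x) (sym (+-suc lo k))
      (zero-keeps-lo (lo-through-zeros k low (λ r r<k → zs r (m<n⇒m<1+n r<k))) (zs k ≤-refl))

    zero-f-fits : ∀ {lo k} → (∀ i → lookup f i ≡ s0) → Zeros lo k → L < k → ⊥
    zero-f-fits {lo} all-zero zs L<k =
      proj₂ a-in (lo , λ i → trans (zs (toℕ i) (≤-<-trans (index-bound i) L<k)) (sym (all-zero i)))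

    -- an f completed at the end of a run of at least L zeros lies inside the run, so f = 0^(L+1)
    bad-after-long-run : ∀ {lo k} → Zeros lo k → L ≤ k → Bad (lo + k) → ∀ i → lookup f i ≡ s0
    bad-after-long-run {lo} {k} zs L≤k bad i with m≤n⇒m<n∨m≡n (index-bound i)
    ... | inj₂ i≡L = f-last i i≡L
    ... | inj₁ i<L = trans (sym (proj₂ (bad-reads (lo + k) bad) i i<L))
                           (zero-inside zs (≤-trans (start-after ends L≤k) (m≤m+n _ _))
                                           (subst (s + toℕ i <_) ends (+-monoʳ-< s i<L)))
      where
      s : ℕ
      s = proj₁ bad
      ends : s + L ≡ lo + k
      ends = proj₁ (bad-reads (lo + k) bad)

    -- a run of k zeros after a nonzero symbol and closed by an occurrence of f is not shorter
    -- than another run closed by an occurrence of f: for k ≥ L both occurrences would consist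
    -- of 0s; for k < L the nonzero symbol sits in f at an index where the longer run has a 0
    shorter-run-impossible : ∀ {l k lo k′} → Zeros (suc l) k → a l ≢ s0 → Bad (suc l + k) →
                             Zeros lo k′ → Bad (lo + k′) → k < k′ → ⊥
    shorter-run-impossible {l} {k} {lo} {k′} zs nonzero bad zs′ bad′ k<k′ with L ≤? k
    ... | yes L≤k = zero-f-fits (bad-after-long-run zs L≤k bad) zs′ (≤-<-trans L≤k k<k′)
    ... | no L≰k with m≤n⇒∃[o]m+o≡n (≰⇒> L≰k) | m≤n⇒∃[o]m+o≡n k<k′
    ...   | d , k+d≡L | t , k+t≡k′ = nonzero (begin
        a l             ≡⟨ cong a (sym at-l) ⟩
        a (s + d)       ≡⟨ cong (λ x → a (s + x)) (sym d-index) ⟩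
        a (s + toℕ i)   ≡⟨ proj₂ (bad-reads (suc l + k) bad) i i<L ⟩
        lookup f i      ≡⟨ sym (proj₂ (bad-reads (lo + k′) bad′) i i<L) ⟩
        a (s′ + toℕ i)  ≡⟨ cong (λ x → a (s′ + x)) d-index ⟩
        a (s′ + d)      ≡⟨ cong a at-t ⟩
        a (lo + t)      ≡⟨ zs′ t (subst (t <_) k+t≡k′ (m<n+m t z<s)) ⟩
        s0              ∎)
      where
      open ≡-Reasoning
      s : ℕ
      s = proj₁ bad
      s′ : ℕ
      s′ = proj₁ bad′
      d<L : d < L
      d<L = subst (d <_) k+d≡L (m<n+m d z<s)
      i : Fin (length f)
      i = index d (<⇒≤ d<L)
      d-index : toℕ i ≡ d
      d-index = toℕ-fromℕ< _
      i<L : toℕ i < L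
      i<L = subst (_< L) (sym d-index) d<L
      -- the short run's occurrence covers position l at index d ...
      at-l : s + d ≡ l
      at-l = shift-back s d (suc k) l
               (trans (cong (s +_) k+d≡L) (trans (proj₁ (bad-reads (suc l + k) bad)) (sym (+-suc l k))))
      -- ... and the long run's occurrence has index d at the zero position lo + t
      at-t : s′ + d ≡ lo + t
      at-t = shift-back s′ d (suc k) (lo + t)
               (trans (cong (s′ +_) k+d≡L) (trans (proj₁ (bad-reads (lo + k′) bad′))
                 (trans (cong (lo +_) (trans (sym k+t≡k′) (+-comm (suc k) t))) (sym (+-assoc lo t (suc k))))))

    record Run (lo k : ℕ) : Set where
      field
        after-p : length p ≤ lo
        low     : ¬ Hi lo
        zeros   : Zeros lo k
        closed  : a (lo + k) ≢ s0

    module _ {lo k : ℕ} (run : Run lo k) where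
      open Run run

      run-end-after-p : length p ≤ lo + k
      run-end-after-p = ≤-trans after-p (m≤m+n lo k)

      run-end-low : ¬ Hi (lo + k)
      run-end-low = lo-through-zeros k low zeros

      run-closed-by-f : ¬ ¬ Bad (lo + k)
      run-closed-by-f = forced-by-f run-end-after-p run-end-low closed

      run-closed-by-one : a (lo + k) ≡ s1
      run-closed-by-one = one-when-lo run-end-after-p run-end-low closed

    -- a run from a low position e ≥ |p| never exceeds L zeros: it would continue forever
    -- (a 0 never completes f inside it), so a would be ultimately 0
    no-long-run : ∀ {e t} → length p ≤ e → ¬ Hi e → Zeros e t → L < t → ⊥
    no-long-run {e} {t} le low zs L<t =
      not-ultimately-0 (constant-tail-ultPeriod s0 e a λ u → grow (suc u) u (s≤s (m≤m+n u t)))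
      where
      grow : ∀ u → Zeros e (u + t)
      grow zero    = zs
      grow (suc u) = zeros-snoc (grow u)
        (zero-when-lo (≤-trans le (m≤m+n e _)) (lo-through-zeros _ low (grow u))
          λ bad → zero-f-fits (bad-after-long-run (grow u) (<⇒≤ L<u+t) bad) (grow u) L<u+t)
        where
        L<u+t : L < u + t
        L<u+t = <-≤-trans L<t (m≤n+m t u)

    -- hence every run from a low position e ≥ |p| ends, as found by scanning L + 1 positions
    runs-end : ∀ {e} → length p ≤ e → ¬ Hi e → Σ ℕ (Run e)
    runs-end {e} le low = scan (suc L) 0 (λ _ ()) (n<1+n L)
      where
      scan : ∀ fuel t → Zeros e t → L < t + fuel → Σ ℕ (Run e)
      scan zero t zs bound = ⊥-elim (no-long-run le low zs (subst (L <_) (+-identityʳ t) bound))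
      scan (suc fuel) t zs bound with a (e + t) ≟F s0
      ... | no nonzero = t , record { after-p = le ; low = low ; zeros = zs ; closed = nonzero }
      ... | yes z      = scan fuel (suc t) (zeros-snoc zs z) (subst (L <_) (+-suc t fuel) bound)

    equal-runs : ∀ {l u l′ m} → a l ≢ s0 → Run (suc l) u → a l′ ≢ s0 → Run (suc l′) m → u ≡ m
    equal-runs {u = u} {m = m} nonzero run nonzero′ run′ with <-cmp u m
    ... | tri≈ _ u≡m _ = u≡m
    ... | tri< u<m _ _ = ⊥-elim (run-closed-by-f run λ bad → run-closed-by-f run′ λ bad′ →
                           shorter-run-impossible (Run.zeros run) nonzero bad (Run.zeros run′) bad′ u<m)
    ... | tri> _ _ m<u = ⊥-elim (run-closed-by-f run′ λ bad′ → run-closed-by-f run λ bad →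
                           shorter-run-impossible (Run.zeros run′) nonzero′ bad′ (Run.zeros run) bad m<u)

    -- Once a run of m zeros follows a nonzero symbol, every high position M ≥ |p| starts the
    -- block (q−1) 0^m 1, after which the word is high again; this yields both periodic tails.
    module Blocks {l m : ℕ} (nonzero : a l ≢ s0) (reference : Run (suc l) m) where

      High : ℕ → Set
      High M = length p ≤ M × Hi M

      top-block : ∀ {M} → High M →
                  a M ≡ sTop × Zeros (suc M) m × a (suc M + m) ≡ s1 × High (suc (suc M + m))
      top-block {M} (le , hi) =
        top , Run.zeros run , one , ≤-trans (run-end-after-p run) (n≤1+n _) , one-makes-hi (run-end-low run) one
        where
        top : a M ≡ sTop
        top = top-when-hi le hi
        found : Σ ℕ (Run (suc M))
        found = runs-end (≤-trans le (n≤1+n M)) (hi-next le hi)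
        run : Run (suc M) m
        run = subst (Run (suc M))
                    (equal-runs (λ z → sTop≢s0 (trans (sym top) z)) (proj₂ found) nonzero reference)
                    (proj₂ found)
        one : a (suc M + m) ≡ s1
        one = run-closed-by-one run

      two-later : ∀ M x → M + suc (suc x) ≡ suc (suc M) + x
      two-later M x = trans (+-suc M (suc x)) (cong suc (+-suc M x))

      high-tail : ∀ {N} → High N → ∀ t → a (N + t) ≡ ((sTop ∷ (replicate m s0 ++ [ s1 ])) ^∞) t
      high-tail = tail-periodic a sTop block High next copy _
        where
        block : List (Fin (suc n))
        block = replicate m s0 ++ [ s1 ]
        length-block : length block ≡ suc m
        length-block = trans (length-++ (replicate m s0)) (trans (cong (_+ 1) (length-replicate m)) (+-comm m 1))
        next : ∀ M → High M → High (M + suc (length block))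
        next M high = subst High (sym (trans (cong (λ x → M + suc x) length-block) (two-later M m)))
                            (proj₂ (proj₂ (proj₂ (top-block high))))
        copy : ∀ M → High M → ∀ i → a (M + toℕ i) ≡ lookup (sTop ∷ block) i
        copy M high F.zero = trans (cong a (+-identityʳ M)) (proj₁ (top-block high))
        copy M high (F.suc i) with m≤n⇒m<n∨m≡n (≤-pred (subst (toℕ i <_) length-block (toℕ<n i)))
        ... | inj₁ i<m = trans (cong a (+-suc M (toℕ i)))
                           (trans (proj₁ (proj₂ (top-block high)) (toℕ i) i<m)
                                  (sym (replicate-∷ʳ-lookup m s0 s1 i i<m)))
        ... | inj₂ i≡m = trans (cong a (trans (+-suc M (toℕ i)) (cong (suc M +_) i≡m)))
                           (trans (proj₁ (proj₂ (proj₂ (top-block high))))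
                                  (sym (lookup-∷ʳ-last (replicate m s0) s1 i (trans i≡m (sym (length-replicate m))))))

      one-tail : ∀ {N} → a N ≡ s1 → High (suc N) → ∀ t → a (N + t) ≡ ((s1 ∷ (sTop ∷ replicate m s0)) ^∞) t
      one-tail one high = tail-periodic a s1 (sTop ∷ replicate m s0) OneHigh next copy _ (one , high)
        where
        OneHigh : ℕ → Set
        OneHigh M = a M ≡ s1 × High (suc M)
        next : ∀ M → OneHigh M → OneHigh (M + suc (length (sTop ∷ replicate m s0)))
        next M (_ , high) = subst OneHigh (sym (trans (cong (λ x → M + suc (suc x)) (length-replicate m)) (two-later M m)))
                                  (proj₂ (proj₂ (top-block high)))
        copy : ∀ M → OneHigh M → ∀ i → a (M + toℕ i) ≡ lookup (s1 ∷ sTop ∷ replicate m s0) i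
        copy M (one , _)    F.zero             = trans (cong a (+-identityʳ M)) one
        copy M (_   , high) (F.suc F.zero)     = trans (cong a (+-comm M 1)) (proj₁ (top-block high))
        copy M (_   , high) (F.suc (F.suc i)) =
          trans (cong a (two-later M (toℕ i)))
                (trans (proj₁ (proj₂ (top-block high)) (toℕ i) (subst (toℕ i <_) (length-replicate m) (toℕ<n i)))
                       (sym (replicate-lookup m s0 i)))

    Shape : Set
    Shape = Σ ℕ (λ m →
      Σ ℕ (λ i → i ≤ m × (a ≈ ((p ++ replicate i s0) ⊙ ((s1 ∷ (sTop ∷ replicate m s0)) ^∞))))
      ⊎ (a ≈ (p ⊙ ((sTop ∷ (replicate m s0 ++ [ s1 ])) ^∞))))

    -- high right after p: a = p ((q−1) 0^m 1)^∞, m the length of the run after position |p|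
    shape-high-start : Hi (length p) → Shape
    shape-high-start hi = proj₁ first-run , inj₂ (⊙-intro p a _ (proj₁ a-in) (high-tail (≤-refl , hi)))
      where
      first-run : Σ ℕ (Run (suc (length p)))
      first-run = runs-end (n≤1+n (length p)) (hi-next ≤-refl hi)
      open Blocks (λ z → sTop≢s0 (trans (sym (top-when-hi ≤-refl hi)) z)) (proj₂ first-run)

    shape-low-start : ¬ Hi (length p) → Shape
    shape-low-start low = m , inj₁ (i , i≤m , a-shape)
      where
      initial : Σ ℕ (Run (length p))
      initial = runs-end ≤-refl low
      i : ℕ
      i = proj₁ initial
      N : ℕ
      N = length p + i
      one : a N ≡ s1
      one = run-closed-by-one (proj₂ initial)
      high : Hi (suc N)
      high = one-makes-hi (run-end-low (proj₂ initial)) one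
      N+1≥p : length p ≤ suc N
      N+1≥p = ≤-trans (run-end-after-p (proj₂ initial)) (n≤1+n N)
      second : Σ ℕ (Run (suc (suc N)))
      second = runs-end (≤-trans N+1≥p (n≤1+n _)) (hi-next N+1≥p high)
      m : ℕ
      m = proj₁ second
      top-nonzero : a (suc N) ≢ s0
      top-nonzero z = sTop≢s0 (trans (sym (top-when-hi N+1≥p high)) z)
      i≤m : i ≤ m
      i≤m = ≮⇒≥ λ m<i → run-closed-by-f (proj₂ second) λ bad → run-closed-by-f (proj₂ initial) λ bad′ →
              shorter-run-impossible (Run.zeros (proj₂ second)) top-nonzero bad (Run.zeros (proj₂ initial)) bad′ m<i
      open Blocks top-nonzero (proj₂ second)
      a-shape : a ≈ ((p ++ replicate i s0) ⊙ ((s1 ∷ (sTop ∷ replicate m s0)) ^∞))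
      a-shape t = trans (⊙-intro p a _ (proj₁ a-in) after-p t) (sym (⊙-++ p (replicate i s0) _ t))
        where
        after-p : ∀ u → a (length p + u) ≡ (replicate i s0 ⊙ ((s1 ∷ (sTop ∷ replicate m s0)) ^∞)) u
        after-p = replicate-⊙-intro i s0 (λ u → a (length p + u)) _ (Run.zeros (proj₂ initial))
                    λ u → trans (cong a (sym (+-assoc (length p) i u))) (one-tail one (N+1≥p , high) u)

    shape : Shape
    shape with parity (length p) ≟ β
    ... | yes hi = shape-high-start hi
    ... | no low = shape-low-start low

proposition1 : (q : ℕ) (h : 2 ≤ q) → 2 ∣ q →
    (f : List (Fin q)) → Σ (List (Fin q)) (λ g → f ≡ g ++ [ sym0 h ]) →
    ¬ ZeroPeriodicity h f →
    (p : List (Fin q)) → Avoids f p →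
    (a : ℕ → Fin q) → (IsFirst f p a ⊎ IsLast f p a) → ¬ UltPeriod a (zeroWord h) →
    Σ ℕ (λ m →
      Σ ℕ (λ i → i ≤ m ×
        (a ≈ ((p ++ replicate i (sym0 h)) ⊙ ((sym1 h ∷ (symLast h ∷ replicate m (sym0 h))) ^∞))))
      ⊎ (a ≈ (p ⊙ ((symLast h ∷ (replicate m (sym0 h) ++ [ sym1 h ])) ^∞))))
-- q = 0 is impossible; otherwise a is greedy for some parity, and Shape.shape reads off its form
proposition1 zero () _ _ _ _ _ _ _ _ _
proposition1 (suc n) h q-even f (g , refl) _ p _ a extremal not-ultimately-0 =
  Shape.shape (proj₁ oriented) (proj₁ (proj₂ oriented)) (proj₂ (proj₂ oriented)) q-even not-ultimately-0
  where
  open Setting n h g p a (extremal-in-cylinder {f = g ++ [ sym0 h ]} {p} extremal)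
  oriented : Σ ℕ λ β → β < 2 × Greedy β
  oriented = extremal-greedy extremal
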